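{- Let $P_n$ be a path on $n\ge 1$ vertices. Then $vcfc(P_n)=\lceil\log_2(n+1)\rceil$.
   Context: Vertex-colorings are arbitrary, not necessarily proper. A path in a vertex-colored graph is called conflict-free if there is a color used on exactly one of its vertices. A vertex-colored graph is conflict-free vertex-connected if any two vertices of the graph are connected by a conflict-free path. For a connected graph $G$, the conflict-free vertex-connection number $vcfc(G)$ is the smallest number of colors needed in a vertex-coloring of $G$ that makes $G$ conflict-free vertex-connected. -}

module Defs where

open import Data.Nat using (ℕ; suc; _≤_)
open import Data.Fin using (Fin; toℕ; _≟_)
open import Data.List using (List; head; last; filter; length)
open import Data.List.Relation.Unary.Linked using (Linked)
open import Data.List.Relation.Unary.Unique.Propositional using (Unique)
open import Data.Maybe using (just)
open import Data.Product using (Σ; ∃; _×_)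
open import Data.Sum using (_⊎_)
open import Relation.Binary.PropositionalEquality using (_≡_)

record Graph : Set₁ where
  field
    n   : ℕ
    Adj : Fin n → Fin n → Set
open Graph public

record IsPath (G : Graph) (u v : Fin (n G)) (vs : List (Fin (n G))) : Set where
  field
    starts   : head vs ≡ just u
    ends     : last vs ≡ just v
    adjacent : Linked (Adj G) vs
    distinct : Unique vs

countColor : ∀ {m k} → (Fin m → Fin k) → Fin k → List (Fin m) → ℕ
countColor col c vs = length (filter (λ x → col x ≟ c) vs)

ConflictFree : ∀ {m k} → (Fin m → Fin k) → List (Fin m) → Set
ConflictFree col vs = ∃ λ c → countColor col c vs ≡ 1

CFVConnecting : (G : Graph) (k : ℕ) → (Fin (n G) → Fin k) → Set
CFVConnecting G k col =
  ∀ (u v : Fin (n G)) → Σ (List (Fin (n G))) λ vs → IsPath G u v vs × ConflictFree col vs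

CFVColorable : Graph → ℕ → Set
CFVColorable G k = Σ (Fin (n G) → Fin k) (CFVConnecting G k)

IsVcfc : Graph → ℕ → Set
IsVcfc G k = CFVColorable G k × (∀ m → CFVColorable G m → k ≤ m)

PathGraph : ℕ → Graph
PathGraph m = record
  { n = m
  ; Adj = λ i j → (toℕ j ≡ suc (toℕ i)) ⊎ (toℕ i ≡ suc (toℕ j)) }

-- Color P_m by the ruler sequence 0 1 0 2 0 1 0 3 …: on every subpath the
-- largest color occurs exactly once, and 2^K − 1 vertices need only K colors.
-- Conversely, on any conflict-free coloring the whole path contains a color c
-- used exactly once; the two subpaths on either side of it avoid c and are again
-- conflict-free, so by induction on the number of colors each has fewer than
-- 2^(k−1) vertices, and the path has fewer than 2^k.
module Submission where

open import Data.Fin as Fin using (Fin; toℕ; fromℕ<)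
open import Data.Fin.Properties using (toℕ-injective; toℕ-fromℕ<; fromℕ<-toℕ; toℕ<n)
open import Data.List using (List; []; _∷_; [_]; _++_; map; filter; length; head; last; upTo)
open import Data.List.Properties
  using (length-++; filter-++; filter-accept; filter-reject; filter-none; filter-some; filter-notAll; length-upTo)
open import Data.List.Membership.Propositional using (_∈_)
open import Data.List.Membership.Propositional.Properties using (∈-filter⁺; ∈-upTo⁺)
open import Data.List.Relation.Unary.All as All using (All; []; _∷_)
open import Data.List.Relation.Unary.All.Properties using (¬Any⇒All¬; ++⁻)
open import Data.List.Relation.Unary.Any as Any using ()
open import Data.List.Relation.Unary.Linked using (Linked; []; [-]; _∷_)
import Data.List.Relation.Unary.Linked.Properties as Linked
open import Data.List.Relation.Unary.Unique.Propositional using (Unique; []; _∷_)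
import Data.List.Relation.Unary.Unique.Propositional.Properties as Unique
open import Data.Maybe as Maybe using (just)
open import Data.Maybe.Properties using (just-injective; map-injective)
open import Data.Nat
open import Data.Nat.Induction using (<-rec)
open import Data.Nat.Logarithm using (⌈log₂_⌉; ⌈log₂⌉-mono-≤; ⌈log₂⌈n/2⌉⌉≡⌈log₂n⌉∸1; ⌈log₂2^n⌉≡n)
open import Data.Nat.Properties
open import Data.Product using (Σ; ∃; ∃₂; _×_; _,_; proj₁; proj₂; uncurry)
open import Data.Sum using (_⊎_; inj₁; inj₂; [_,_]′)
open import Function using (_∘_)
open import Relation.Binary using (tri<; tri≈; tri>)
open import Relation.Nullary using (yes; no; ¬?; contradiction)
open import Relation.Binary.PropositionalEquality
  using (_≡_; _≢_; refl; sym; trans; cong; cong₂; subst; subst₂; module ≡-Reasoning)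

open import Defs

2^n+2^n≡2^[1+n] : ∀ n → 2 ^ n + 2 ^ n ≡ 2 ^ suc n
2^n+2^n≡2^[1+n] n = cong (2 ^ n +_) (sym (+-identityʳ (2 ^ n)))

n≤⌈n/2⌉+⌈n/2⌉ : ∀ n → n ≤ ⌈ n /2⌉ + ⌈ n /2⌉
n≤⌈n/2⌉+⌈n/2⌉ n =
  subst (_≤ ⌈ n /2⌉ + ⌈ n /2⌉) (⌊n/2⌋+⌈n/2⌉≡n n) (+-monoˡ-≤ ⌈ n /2⌉ (⌊n/2⌋≤⌈n/2⌉ n))

n≤2^⌈log₂n⌉ : ∀ n → n ≤ 2 ^ ⌈log₂ n ⌉
n≤2^⌈log₂n⌉ = <-rec (λ n → n ≤ 2 ^ ⌈log₂ n ⌉) bound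
  where
  bound : ∀ n → (∀ {m} → m < n → m ≤ 2 ^ ⌈log₂ m ⌉) → n ≤ 2 ^ ⌈log₂ n ⌉
  bound 0 _ = z≤n
  bound 1 _ = m^n>0 2 ⌈log₂ 1 ⌉
  bound n@(suc (suc k)) rec = begin
    n                                         ≤⟨ n≤⌈n/2⌉+⌈n/2⌉ n ⟩
    ⌈ n /2⌉ + ⌈ n /2⌉                         ≤⟨ +-mono-≤ half≤ half≤ ⟩
    2 ^ ⌈log₂ ⌈ n /2⌉ ⌉ + 2 ^ ⌈log₂ ⌈ n /2⌉ ⌉
      ≡⟨ cong (λ e → 2 ^ e + 2 ^ e) (⌈log₂⌈n/2⌉⌉≡⌈log₂n⌉∸1 n) ⟩
    2 ^ (L ∸ 1) + 2 ^ (L ∸ 1)                 ≡⟨ 2^n+2^n≡2^[1+n] (L ∸ 1) ⟩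
    2 ^ suc (L ∸ 1)                           ≡⟨ cong (2 ^_) (m+[n∸m]≡n 1≤L) ⟩
    2 ^ L                                     ∎
    where
    open ≤-Reasoning
    L : ℕ
    L = ⌈log₂ n ⌉
    1≤L : 1 ≤ L
    1≤L = ⌈log₂⌉-mono-≤ {2} {n} (s≤s (s≤s z≤n))
    half≤ : ⌈ n /2⌉ ≤ 2 ^ ⌈log₂ ⌈ n /2⌉ ⌉
    half≤ = rec (⌈n/2⌉<n k)

m<2^k⇒⌈log₂1+m⌉≤k : ∀ {m k} → m < 2 ^ k → ⌈log₂ suc m ⌉ ≤ k
m<2^k⇒⌈log₂1+m⌉≤k {m} {k} m<2^k = subst (⌈log₂ suc m ⌉ ≤_) (⌈log₂2^n⌉≡n k) (⌈log₂⌉-mono-≤ m<2^k)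

occurrences : (ℕ → ℕ) → ℕ → List ℕ → ℕ
occurrences g c xs = length (filter (λ x → g x ≟ c) xs)

HasUniqueColor : (ℕ → ℕ) → List ℕ → Set
HasUniqueColor g xs = ∃ λ c → occurrences g c xs ≡ 1

occurrences-++ : ∀ g c xs ys →
                 occurrences g c (xs ++ ys) ≡ occurrences g c xs + occurrences g c ys
occurrences-++ g c xs ys =
  trans (cong length (filter-++ (λ x → g x ≟ c) xs ys)) (length-++ (filter (λ x → g x ≟ c) xs))

occurrences-accept : ∀ {g c} x xs → g x ≡ c → occurrences g c (x ∷ xs) ≡ suc (occurrences g c xs)
occurrences-accept {g} {c} _ _ gx≡c = cong length (filter-accept (λ x → g x ≟ c) gx≡c)

occurrences-reject : ∀ {g c} x xs → g x ≢ c → occurrences g c (x ∷ xs) ≡ occurrences g c xs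
occurrences-reject {g} {c} _ _ gx≢c = cong length (filter-reject (λ x → g x ≟ c) gx≢c)

occurrences-cong : ∀ {g h} c xs → All (λ x → g x ≡ h x) xs →
                   occurrences g c xs ≡ occurrences h c xs
occurrences-cong c [] [] = refl
occurrences-cong {g} {h} c (x ∷ xs) (gx≡hx ∷ rest) with g x ≟ c
... | yes gx≡c = begin
  occurrences g c (x ∷ xs)    ≡⟨ occurrences-accept x xs gx≡c ⟩
  suc (occurrences g c xs)    ≡⟨ cong suc (occurrences-cong c xs rest) ⟩
  suc (occurrences h c xs)    ≡⟨ occurrences-accept x xs (trans (sym gx≡hx) gx≡c) ⟨
  occurrences h c (x ∷ xs)    ∎
  where open ≡-Reasoning
... | no gx≢c = begin
  occurrences g c (x ∷ xs)    ≡⟨ occurrences-reject x xs gx≢c ⟩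
  occurrences g c xs          ≡⟨ occurrences-cong c xs rest ⟩
  occurrences h c xs          ≡⟨ occurrences-reject x xs (gx≢c ∘ trans gx≡hx) ⟨
  occurrences h c (x ∷ xs)    ∎
  where open ≡-Reasoning

occurrences-map : ∀ g c f xs → occurrences g c (map f xs) ≡ occurrences (g ∘ f) c xs
occurrences-map g c f []       = refl
occurrences-map g c f (x ∷ xs) with g (f x) ≟ c
... | yes gfx≡c = begin
  occurrences g c (f x ∷ map f xs)  ≡⟨ occurrences-accept (f x) (map f xs) gfx≡c ⟩
  suc (occurrences g c (map f xs))  ≡⟨ cong suc (occurrences-map g c f xs) ⟩
  suc (occurrences (g ∘ f) c xs)    ≡⟨ occurrences-accept x xs gfx≡c ⟨
  occurrences (g ∘ f) c (x ∷ xs)    ∎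
  where open ≡-Reasoning
... | no gfx≢c = begin
  occurrences g c (f x ∷ map f xs)  ≡⟨ occurrences-reject (f x) (map f xs) gfx≢c ⟩
  occurrences g c (map f xs)        ≡⟨ occurrences-map g c f xs ⟩
  occurrences (g ∘ f) c xs          ≡⟨ occurrences-reject x xs gfx≢c ⟨
  occurrences (g ∘ f) c (x ∷ xs)    ∎
  where open ≡-Reasoning

occurrences-none : ∀ {g c} xs → All (λ x → g x ≢ c) xs → occurrences g c xs ≡ 0
occurrences-none {g} {c} _ avoid = cong length (filter-none (λ x → g x ≟ c) avoid)

occurrences-none⁻ : ∀ {g c} xs → occurrences g c xs ≡ 0 → All (λ x → g x ≢ c) xs
occurrences-none⁻ {g} {c} xs none =
  ¬Any⇒All¬ xs (λ some → <⇒≢ (filter-some (λ x → g x ≟ c) some) (sym none))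

occurring⇒< : ∀ {g c k} xs → All (λ x → g x < k) xs → 0 < occurrences g c xs → c < k
occurring⇒< {g} {c} (x ∷ xs) (gx<k ∷ rest) occurs with g x ≟ c
... | yes refl = gx<k
... | no gx≢c  = occurring⇒< xs rest (subst (0 <_) (occurrences-reject x xs gx≢c) occurs)

_without_ : List ℕ → ℕ → List ℕ
S without c = filter (λ x → ¬? (x ≟ c)) S

length-without : ∀ {c S} → c ∈ S → length (S without c) < length S
length-without {c} {S} c∈S =
  filter-notAll (λ x → ¬? (x ≟ c)) S (Any.map (λ c≡x x≢c → x≢c (sym c≡x)) c∈S)

∈-without : ∀ {c x S} → x ∈ S → x ≢ c → x ∈ S without c
∈-without {c} = ∈-filter⁺ (λ x → ¬? (x ≟ c))

interval : ℕ → ℕ → List ℕ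
interval a zero    = []
interval a (suc l) = a ∷ interval (suc a) l

descending : ℕ → ℕ → List ℕ
descending a zero    = []
descending a (suc l) = a + l ∷ descending a l

interval-++ : ∀ a p q → interval a (p + q) ≡ interval a p ++ interval (a + p) q
interval-++ a zero    q = cong (λ b → interval b q) (sym (+-identityʳ a))
interval-++ a (suc p) q = cong (a ∷_) (trans (interval-++ (suc a) p q)
  (cong (λ b → interval (suc a) p ++ interval b q) (sym (+-suc a p))))

interval-∷ʳ : ∀ a l → interval a (suc l) ≡ interval a l ++ [ a + l ]
interval-∷ʳ a l = trans (cong (interval a) (+-comm 1 l)) (interval-++ a l 1)

interval-shift : ∀ d a l → interval (d + a) l ≡ map (d +_) (interval a l)
interval-shift d a zero    = refl
interval-shift d a (suc l) = cong (d + a ∷_)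
  (trans (cong (λ b → interval b l) (sym (+-suc d a))) (interval-shift d (suc a) l))

last-interval : ∀ a l → last (interval a (suc l)) ≡ just (a + l)
last-interval a zero    = cong just (sym (+-identityʳ a))
last-interval a (suc l) = trans (last-interval (suc a) l) (cong just (sym (+-suc a l)))

last-descending : ∀ a l → last (descending a (suc l)) ≡ just a
last-descending a zero    = cong just (+-identityʳ a)
last-descending a (suc l) = last-descending a l

All-interval : ∀ {P : ℕ → Set} {a l} → (∀ {x} → a ≤ x → x < a + l → P x) → All P (interval a l)
All-interval {a = a} {zero}  f = []
All-interval {a = a} {suc l} f = f ≤-refl (m<m+n a z<s)
  ∷ All-interval (λ {x} a<x x< → f (<⇒≤ a<x) (subst (x <_) (sym (+-suc a l)) x<))

All-descending : ∀ {P : ℕ → Set} {a l} → (∀ {x} → a ≤ x → x < a + l → P x) → All P (descending a l)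
All-descending {a = a} {zero}  f = []
All-descending {a = a} {suc l} f = f (m≤m+n a l) a+l<a+1+l
  ∷ All-descending (λ a≤x x< → f a≤x (<-trans x< a+l<a+1+l))
  where
  a+l<a+1+l : a + l < a + suc l
  a+l<a+1+l = +-monoʳ-< a (n<1+n l)

occurrences-descending : ∀ g c a l →
                         occurrences g c (descending a l) ≡ occurrences g c (interval a l)
occurrences-descending g c a zero    = refl
occurrences-descending g c a (suc l) = begin
  occurrences g c ([ x ] ++ descending a l)          ≡⟨ occurrences-++ g c [ x ] (descending a l) ⟩
  occurrences g c [ x ] + occurrences g c (descending a l)
    ≡⟨ cong (occurrences g c [ x ] +_) (occurrences-descending g c a l) ⟩
  occurrences g c [ x ] + occurrences g c (interval a l) ≡⟨ +-comm _ (occurrences g c (interval a l)) ⟩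
  occurrences g c (interval a l) + occurrences g c [ x ] ≡⟨ occurrences-++ g c (interval a l) [ x ] ⟨
  occurrences g c (interval a l ++ [ x ])                ≡⟨ cong (occurrences g c) (interval-∷ʳ a l) ⟨
  occurrences g c (interval a (suc l))                   ∎
  where
  open ≡-Reasoning
  x : ℕ
  x = a + l

Adjacentℕ : ℕ → ℕ → Set
Adjacentℕ a b = b ≡ suc a ⊎ a ≡ suc b

Ascending Descending : List ℕ → Set
Ascending  = Linked (λ a b → b ≡ suc a)
Descending = Linked (λ a b → a ≡ suc b)

interval-linked : ∀ a l → Linked Adjacentℕ (interval a l)
interval-linked a zero          = []
interval-linked a (suc zero)    = [-]
interval-linked a (suc (suc l)) = inj₁ refl ∷ interval-linked (suc a) (suc l)

interval-unique : ∀ a l → Unique (interval a l)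
interval-unique a zero    = []
interval-unique a (suc l) = All-interval (λ a<x _ → <⇒≢ a<x) ∷ interval-unique (suc a) l

descending-linked : ∀ a l → Linked Adjacentℕ (descending a l)
descending-linked a zero          = []
descending-linked a (suc zero)    = [-]
descending-linked a (suc (suc l)) = inj₂ (+-suc a l) ∷ descending-linked a (suc l)

descending-unique : ∀ a l → Unique (descending a l)
descending-unique a zero    = []
descending-unique a (suc l) = All-descending (λ _ x<a+l → >⇒≢ x<a+l) ∷ descending-unique a l

-- Uniqueness forbids turning back, since x, x ± 1, x would repeat x.
ascending-or-descending : ∀ {xs} → Linked Adjacentℕ xs → Unique xs → Ascending xs ⊎ Descending xs
ascending-or-descending []                 _ = inj₁ []
ascending-or-descending [-]                _ = inj₁ [-]
ascending-or-descending (inj₁ up ∷ [-])    _ = inj₁ (up ∷ [-])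
ascending-or-descending (inj₂ down ∷ [-])  _ = inj₂ (down ∷ [-])
ascending-or-descending (step ∷ steps@(_ ∷ _)) ((_ ∷ x≢z ∷ _) ∷ unique)
  with step | ascending-or-descending steps unique
... | inj₁ up   | inj₁ ups         = inj₁ (up ∷ ups)
... | inj₂ down | inj₂ downs       = inj₂ (down ∷ downs)
... | inj₁ up   | inj₂ (down ∷ _)  = contradiction (suc-injective (trans (sym up) down)) x≢z
... | inj₂ down | inj₁ (up ∷ _)    = contradiction (trans down (sym up)) x≢z

ascending⇒interval : ∀ {x xs} → Ascending (x ∷ xs) → x ∷ xs ≡ interval x (suc (length xs))
ascending⇒interval [-]          = refl
ascending⇒interval {x} (refl ∷ ups) = cong (x ∷_) (ascending⇒interval ups)

descending⇒last≤head : ∀ {x xs t} → Descending (x ∷ xs) → last (x ∷ xs) ≡ just t → t ≤ x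
descending⇒last≤head [-]            refl = ≤-refl
descending⇒last≤head (refl ∷ downs) ends = m≤n⇒m≤1+n (descending⇒last≤head downs ends)

path⇒interval : ∀ {xs} s l → Linked Adjacentℕ xs → Unique xs →
                head xs ≡ just s → last xs ≡ just (s + l) → xs ≡ interval s (suc l)
path⇒interval {x ∷ xs} s l linked unique refl ends with ascending-or-descending linked unique
... | inj₁ ups = trans (ascending⇒interval ups) (cong (λ n → interval x (suc n)) |xs|≡l)
  where
  |xs|≡l : length xs ≡ l
  |xs|≡l = +-cancelˡ-≡ x _ _ (just-injective (begin
    just (x + length xs)          ≡⟨ last-interval x (length xs) ⟨
    last (interval x (suc (length xs))) ≡⟨ cong last (ascending⇒interval ups) ⟨
    last (x ∷ xs)                 ≡⟨ ends ⟩
    just (x + l)                  ∎))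
    where open ≡-Reasoning
path⇒interval {x ∷ []} s l _ _ refl ends | inj₂ _ =
  cong (λ n → interval x (suc n)) (+-cancelˡ-≡ x 0 l (trans (+-identityʳ x) (just-injective ends)))
path⇒interval {x ∷ y ∷ ys} s l _ _ refl ends | inj₂ (refl ∷ downs) =
  contradiction (s≤s (descending⇒last≤head downs ends)) (m+n≮m x l)

IntervalsConflictFree : (ℕ → ℕ) → ℕ → ℕ → Set
IntervalsConflictFree g a L =
  ∀ s l → a ≤ s → s + suc l ≤ a + L → HasUniqueColor g (interval s (suc l))

IntervalsConflictFree-mono : ∀ {g a L a′ L′} → a ≤ a′ → a′ + L′ ≤ a + L →
                             IntervalsConflictFree g a L → IntervalsConflictFree g a′ L′
IntervalsConflictFree-mono a≤a′ inside cf s l a′≤s ends =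
  cf s l (≤-trans a≤a′ a′≤s) (≤-trans ends inside)

IntervalsConflictFree-cong : ∀ {g h a L} → (∀ {x} → a ≤ x → x < a + L → g x ≡ h x) →
                             IntervalsConflictFree g a L → IntervalsConflictFree h a L
IntervalsConflictFree-cong g≡h cf s l a≤s ends with cf s l a≤s ends
... | c , once = c , trans (sym (occurrences-cong c (interval s (suc l)) (All-interval λ s≤x x< →
                   g≡h (≤-trans a≤s s≤x) (<-≤-trans x< ends)))) once

unique-occurrence-split : ∀ g c a L → occurrences g c (interval a L) ≡ 1 →
  ∃₂ λ p q → L ≡ p + suc q × g (a + p) ≡ c ×
             All (λ x → g x ≢ c) (interval a p) × All (λ x → g x ≢ c) (interval (suc (a + p)) q)
unique-occurrence-split g c a (suc L) once with g a ≟ c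
... | yes ga≡c =
  0 , L , refl , trans (cong g (+-identityʳ a)) ga≡c , [] ,
  subst (λ b → All (λ x → g x ≢ c) (interval (suc b) L)) (sym (+-identityʳ a))
    (occurrences-none⁻ (interval (suc a) L)
      (suc-injective (trans (sym (occurrences-accept {g} a (interval (suc a) L) ga≡c)) once)))
... | no ga≢c
  with unique-occurrence-split g c (suc a) L
         (trans (sym (occurrences-reject {g} a (interval (suc a) L) ga≢c)) once)
... | p , q , L≡p+1+q , gc , avoidˡ , avoidʳ =
  suc p , q , cong suc L≡p+1+q , trans (cong g (+-suc a p)) gc , ga≢c ∷ avoidˡ ,
  subst (λ b → All (λ x → g x ≢ c) (interval (suc b) q)) (sym (+-suc a p)) avoidʳ

conflictFree⇒<2^ : ∀ k {g S} a L → length S ≤ k → All (λ x → g x ∈ S) (interval a L) →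
                   IntervalsConflictFree g a L → L < 2 ^ k
conflictFree⇒<2^ k a zero _ _ _ = m^n>0 2 k
conflictFree⇒<2^ zero {S = []}    a (suc L) _  (() ∷ _) _
conflictFree⇒<2^ zero {S = _ ∷ _} a (suc L) () _        _
conflictFree⇒<2^ (suc k) {g} {S} a (suc L) |S|≤1+k colors cf with cf a L ≤-refl ≤-refl
... | c , once with unique-occurrence-split g c a (suc L) once
... | p , q , L≡p+1+q , gc , avoidˡ , avoidʳ =
  subst₂ _<_ (sym L≡p+1+q) (2^n+2^n≡2^[1+n] k) (+-mono-≤ p<2^k q<2^k)
  where
  colors-split : All (λ x → g x ∈ S) (interval a p) ×
                 All (λ x → g x ∈ S) (a + p ∷ interval (suc (a + p)) q)
  colors-split = ++⁻ (interval a p)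
    (subst (All _) (trans (cong (interval a) L≡p+1+q) (interval-++ a p (suc q))) colors)
  |S-c|≤k : length (S without c) ≤ k
  |S-c|≤k =
    s≤s⁻¹ (<-≤-trans (length-without (subst (_∈ S) gc (All.head (proj₂ colors-split)))) |S|≤1+k)
  restrict : ∀ {xs} → All (λ x → g x ∈ S) xs → All (λ x → g x ≢ c) xs →
             All (λ x → g x ∈ S without c) xs
  restrict inS avoid = All.zipWith (uncurry ∈-without) (inS , avoid)
  end≡ : suc (a + p) + q ≡ a + suc L
  end≡ = trans (sym (+-suc (a + p) q)) (trans (+-assoc a p (suc q)) (cong (a +_) (sym L≡p+1+q)))
  p<2^k : p < 2 ^ k
  p<2^k = conflictFree⇒<2^ k a p |S-c|≤k (restrict (proj₁ colors-split) avoidˡ)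
    (IntervalsConflictFree-mono {g} ≤-refl
      (+-monoʳ-≤ a (≤-trans (m≤m+n p (suc q)) (≤-reflexive (sym L≡p+1+q)))) cf)
  q<2^k : q < 2 ^ k
  q<2^k = conflictFree⇒<2^ k (suc (a + p)) q |S-c|≤k
    (restrict (All.tail (proj₂ colors-split)) avoidʳ)
    (IntervalsConflictFree-mono {g} (m≤n⇒m≤1+n (m≤m+n a p)) (≤-reflexive end≡) cf)

rulerLength : ℕ → ℕ
rulerLength zero    = 0
rulerLength (suc K) = rulerLength K + suc (rulerLength K)

1+rulerLength≡2^ : ∀ K → suc (rulerLength K) ≡ 2 ^ K
1+rulerLength≡2^ zero    = refl
1+rulerLength≡2^ (suc K) =
  trans (cong₂ _+_ (1+rulerLength≡2^ K) (1+rulerLength≡2^ K)) (2^n+2^n≡2^[1+n] K)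

ruler : ℕ → ℕ → ℕ
ruler zero    x = 0
ruler (suc K) x with <-cmp x (rulerLength K)
... | tri< _ _ _ = ruler K x
... | tri≈ _ _ _ = K
... | tri> _ _ _ = ruler K (x ∸ suc (rulerLength K))

x∸[1+n]<n : ∀ {n x} → n < x → x < n + suc n → x ∸ suc n < n
x∸[1+n]<n {n} {x} n<x x< = subst (x ∸ suc n <_) (m+n∸n≡m n (suc n)) (∸-monoˡ-< x< n<x)

ruler-left : ∀ K {x} → x < rulerLength K → ruler (suc K) x ≡ ruler K x
ruler-left K {x} x<n with <-cmp x (rulerLength K)
... | tri< _ _ _   = refl
... | tri≈ _ x≡n _ = contradiction x≡n (<⇒≢ x<n)
... | tri> _ _ n<x = contradiction n<x (<-asym x<n)

ruler-middle : ∀ K → ruler (suc K) (rulerLength K) ≡ K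
ruler-middle K with <-cmp (rulerLength K) (rulerLength K)
... | tri< _ n≢n _ = contradiction refl n≢n
... | tri≈ _ _ _   = refl
... | tri> _ n≢n _ = contradiction refl n≢n

ruler-right : ∀ K y → ruler (suc K) (suc (rulerLength K) + y) ≡ ruler K y
ruler-right K y with <-cmp (suc (rulerLength K) + y) (rulerLength K)
... | tri< x<n _ _ = contradiction x<n (<-asym (s≤s (m≤m+n (rulerLength K) y)))
... | tri≈ _ x≡n _ = contradiction x≡n (>⇒≢ (s≤s (m≤m+n (rulerLength K) y)))
... | tri> _ _ _   = cong (ruler K) (m+n∸m≡n (suc (rulerLength K)) y)

ruler-< : ∀ K {x} → x < rulerLength K → ruler K x < K
ruler-< (suc K) {x} x< with <-cmp x (rulerLength K)
... | tri< x<n _ _ = m<n⇒m<1+n (ruler-< K x<n)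
... | tri≈ _ _ _   = n<1+n K
... | tri> _ _ n<x = m<n⇒m<1+n (ruler-< K (x∸[1+n]<n n<x x<))

ruler-off-middle : ∀ K {x} → x < rulerLength (suc K) → x ≢ rulerLength K → ruler (suc K) x < K
ruler-off-middle K {x} x< x≢n with <-cmp x (rulerLength K)
... | tri< x<n _ _ = ruler-< K x<n
... | tri≈ _ x≡n _ = contradiction x≡n x≢n
... | tri> _ _ n<x = ruler-< K (x∸[1+n]<n n<x x<)

occurrences-ruler-left : ∀ K c s l → s + l ≤ rulerLength K →
  occurrences (ruler (suc K)) c (interval s l) ≡ occurrences (ruler K) c (interval s l)
occurrences-ruler-left K c s l inLeft =
  occurrences-cong c (interval s l) (All-interval λ _ x< → ruler-left K (<-≤-trans x< inLeft))

occurrences-ruler-right : ∀ K c s l →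
  occurrences (ruler (suc K)) c (interval (suc (rulerLength K) + s) l) ≡
  occurrences (ruler K) c (interval s l)
occurrences-ruler-right K c s l = begin
  occurrences (ruler (suc K)) c (interval (d + s) l)
    ≡⟨ cong (occurrences (ruler (suc K)) c) (interval-shift d s l) ⟩
  occurrences (ruler (suc K)) c (map (d +_) (interval s l))
    ≡⟨ occurrences-map (ruler (suc K)) c (d +_) (interval s l) ⟩
  occurrences (ruler (suc K) ∘ (d +_)) c (interval s l)
    ≡⟨ occurrences-cong c (interval s l) (All.universal (ruler-right K) _) ⟩
  occurrences (ruler K) c (interval s l)
    ∎
  where
  open ≡-Reasoning
  d : ℕ
  d = suc (rulerLength K)

occurrences-ruler-middle : ∀ K {s l} → s ≤ rulerLength K → rulerLength K < s + l →
  s + l ≤ rulerLength (suc K) → occurrences (ruler (suc K)) K (interval s l) ≡ 1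
occurrences-ruler-middle K {s} {l} s≤n n<s+l s+l≤ with m≤n⇒∃[o]m+o≡n s≤n
... | d , s+d≡n with m≤n⇒∃[o]m+o≡n (+-cancelˡ-< s d l (subst (_< s + l) (sym s+d≡n) n<s+l))
... | e , 1+d+e≡l = begin
  occurrences g K (interval s l)
    ≡⟨ cong (occurrences g K) split ⟩
  occurrences g K (interval s d ++ s + d ∷ interval (suc (s + d)) e)
    ≡⟨ occurrences-++ g K (interval s d) _ ⟩
  occurrences g K (interval s d) + occurrences g K (s + d ∷ interval (suc (s + d)) e)
    ≡⟨ cong₂ _+_ before (occurrences-accept {g} (s + d) _ (trans (cong g s+d≡n) (ruler-middle K))) ⟩
  suc (occurrences g K (interval (suc (s + d)) e))
    ≡⟨ cong suc after ⟩
  1 ∎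
  where
  open ≡-Reasoning
  g : ℕ → ℕ
  g = ruler (suc K)
  mid : ℕ
  mid = rulerLength K
  l≡d+1+e : l ≡ d + suc e
  l≡d+1+e = trans (sym 1+d+e≡l) (sym (+-suc d e))
  split : interval s l ≡ interval s d ++ s + d ∷ interval (suc (s + d)) e
  split = trans (cong (interval s) l≡d+1+e) (interval-++ s d (suc e))
  end≡ : suc (s + d) + e ≡ s + l
  end≡ = trans (sym (+-suc (s + d) e)) (trans (+-assoc s d (suc e)) (cong (s +_) (sym l≡d+1+e)))
  avoids-K : ∀ {x} → x < rulerLength (suc K) → x ≢ mid → g x ≢ K
  avoids-K x< x≢n = <⇒≢ (ruler-off-middle K x< x≢n)
  before : occurrences g K (interval s d) ≡ 0
  before = occurrences-none (interval s d) (All-interval λ {x} _ x<s+d →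
    let x<n = subst (x <_) s+d≡n x<s+d in avoids-K (<-≤-trans x<n (m≤m+n mid (suc mid))) (<⇒≢ x<n))
  after : occurrences g K (interval (suc (s + d)) e) ≡ 0
  after = occurrences-none (interval (suc (s + d)) e) (All-interval λ {x} s+d<x x< →
    avoids-K (<-≤-trans (subst (x <_) end≡ x<) s+l≤) (>⇒≢ (subst (_< x) s+d≡n s+d<x)))

ruler-conflictFree : ∀ K → IntervalsConflictFree (ruler K) 0 (rulerLength K)
ruler-conflictFree zero s l _ ends = contradiction (n≤0⇒n≡0 ends) (m+1+n≢0 s)
ruler-conflictFree (suc K) s l _ ends with s + suc l ≤? rulerLength K | rulerLength K <? s
... | yes inLeft | _ with ruler-conflictFree K s l z≤n inLeft
...   | c , once = c , trans (occurrences-ruler-left K c s (suc l) inLeft) once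
ruler-conflictFree (suc K) s l _ ends | no _ | yes inRight with m≤n⇒∃[o]m+o≡n inRight
... | s′ , refl with ruler-conflictFree K s′ l z≤n inRight′
  where
  mid : ℕ
  mid = rulerLength K
  inRight′ : s′ + suc l ≤ mid
  inRight′ = +-cancelˡ-≤ (suc mid) (s′ + suc l) mid
    (subst₂ _≤_ (+-assoc (suc mid) s′ (suc l)) (+-comm mid (suc mid)) ends)
...   | c , once = c , trans (occurrences-ruler-right K c s′ (suc l)) once
ruler-conflictFree (suc K) s l _ ends | no notLeft | no notRight =
  K , occurrences-ruler-middle K (≮⇒≥ notRight) (≰⇒> notLeft) ends

head-map : ∀ {A B : Set} (f : A → B) xs → head (map f xs) ≡ Maybe.map f (head xs)
head-map f []      = refl
head-map f (x ∷ _) = refl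

last-map : ∀ {A B : Set} (f : A → B) xs → last (map f xs) ≡ Maybe.map f (last xs)
last-map f []           = refl
last-map f (x ∷ [])     = refl
last-map f (x ∷ y ∷ xs) = last-map f (y ∷ xs)

-- Vertices outside P_m get the junk color 0; only the values below m are ever used.
extend : ∀ {m k} → (Fin m → Fin k) → ℕ → ℕ
extend {m} col x with x <? m
... | yes x<m = toℕ (col (fromℕ< x<m))
... | no _    = 0

extend-fromℕ< : ∀ {m k} (col : Fin m → Fin k) {x} (x<m : x < m) →
                extend col x ≡ toℕ (col (fromℕ< x<m))
extend-fromℕ< {m} col {x} x<m with x <? m
... | yes _   = refl
... | no x≮m  = contradiction x<m x≮m

extend-toℕ : ∀ {m k} (col : Fin m → Fin k) i → extend col (toℕ i) ≡ toℕ (col i)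
extend-toℕ col i = trans (extend-fromℕ< col (toℕ<n i)) (cong (toℕ ∘ col) (fromℕ<-toℕ i (toℕ<n i)))

extend-< : ∀ {m k} (col : Fin m → Fin k) {x} → x < m → extend col x < k
extend-< col x<m = subst (_< _) (sym (extend-fromℕ< col x<m)) (toℕ<n (col (fromℕ< x<m)))

countColor-toℕ : ∀ {m k} (col : Fin m → Fin k) c vs →
                 countColor col c vs ≡ occurrences (extend col) (toℕ c) (map toℕ vs)
countColor-toℕ col c [] = refl
countColor-toℕ col c (v ∷ vs) with col v Fin.≟ c
... | yes refl = begin
  suc (countColor col (col v) vs)
    ≡⟨ cong suc (countColor-toℕ col _ vs) ⟩
  suc (occurrences (extend col) (toℕ (col v)) (map toℕ vs))
    ≡⟨ occurrences-accept {extend col} (toℕ v) _ (extend-toℕ col v) ⟨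
  occurrences (extend col) (toℕ (col v)) (toℕ v ∷ map toℕ vs)
    ∎
  where open ≡-Reasoning
... | no cv≢c = begin
  countColor col c vs
    ≡⟨ countColor-toℕ col c vs ⟩
  occurrences (extend col) (toℕ c) (map toℕ vs)
    ≡⟨ occurrences-reject {extend col} (toℕ v) _ ext≢c ⟨
  occurrences (extend col) (toℕ c) (toℕ v ∷ map toℕ vs)
    ∎
  where
  open ≡-Reasoning
  ext≢c : extend col (toℕ v) ≢ toℕ c
  ext≢c ext≡c = cv≢c (toℕ-injective (trans (sym (extend-toℕ col v)) ext≡c))

toFins : ∀ {m xs} → All (_< m) xs → List (Fin m)
toFins = All.reduce (λ x<m → fromℕ< x<m)

map-toℕ-toFins : ∀ {m xs} (xs<m : All (_< m) xs) → map toℕ (toFins xs<m) ≡ xs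
map-toℕ-toFins []           = refl
map-toℕ-toFins (x<m ∷ rest) = cong₂ _∷_ (toℕ-fromℕ< x<m) (map-toℕ-toFins rest)

pathGraph-path⇒interval : ∀ {m} {u v : Fin m} {vs} s l → IsPath (PathGraph m) u v vs →
                          toℕ u ≡ s → toℕ v ≡ s + l → map toℕ vs ≡ interval s (suc l)
pathGraph-path⇒interval {vs = vs} s l path u≡s v≡s+l =
  path⇒interval s l (Linked.map⁺ adjacent) (Unique.map⁺ toℕ-injective distinct)
    (trans (head-map toℕ vs) (trans (cong (Maybe.map toℕ) starts) (cong just u≡s)))
    (trans (last-map toℕ vs) (trans (cong (Maybe.map toℕ) ends) (cong just v≡s+l)))
  where open IsPath path

ℕ-path⇒pathGraph-path : ∀ {m} {u v : Fin m} {xs} (xs<m : All (_< m) xs) →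
  Linked Adjacentℕ xs → Unique xs → head xs ≡ just (toℕ u) → last xs ≡ just (toℕ v) →
  IsPath (PathGraph m) u v (toFins xs<m)
ℕ-path⇒pathGraph-path {xs = xs} xs<m linked unique starts ends = record
  { starts   = map-injective toℕ-injective
                 (trans (sym (head-map toℕ (toFins xs<m))) (trans (cong head toℕs≡xs) starts))
  ; ends     = map-injective toℕ-injective
                 (trans (sym (last-map toℕ (toFins xs<m))) (trans (cong last toℕs≡xs) ends))
  ; adjacent = Linked.map⁻ (subst (Linked Adjacentℕ) (sym toℕs≡xs) linked)
  ; distinct = Unique.map⁻ (subst Unique (sym toℕs≡xs) unique)
  }
  where
  toℕs≡xs : map toℕ (toFins xs<m) ≡ xs
  toℕs≡xs = map-toℕ-toFins xs<m

conflictFree-ℕ-path : ∀ {m k} (col : Fin m → Fin k) {u v : Fin m} {xs} (xs<m : All (_< m) xs) →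
  Linked Adjacentℕ xs → Unique xs → head xs ≡ just (toℕ u) → last xs ≡ just (toℕ v) →
  HasUniqueColor (extend col) xs →
  Σ (List (Fin m)) λ vs → IsPath (PathGraph m) u v vs × ConflictFree col vs
conflictFree-ℕ-path {k = k} col {xs = xs} xs<m linked unique starts ends (c , once) =
  toFins xs<m , ℕ-path⇒pathGraph-path xs<m linked unique starts ends , fromℕ< c<k , (begin
    countColor col (fromℕ< c<k) (toFins xs<m)
      ≡⟨ countColor-toℕ col (fromℕ< c<k) (toFins xs<m) ⟩
    occurrences (extend col) (toℕ (fromℕ< c<k)) (map toℕ (toFins xs<m))
      ≡⟨ cong₂ (occurrences (extend col)) (toℕ-fromℕ< c<k) (map-toℕ-toFins xs<m) ⟩
    occurrences (extend col) c xs
      ≡⟨ once ⟩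
    1 ∎)
  where
  open ≡-Reasoning
  c<k : c < k
  c<k = occurring⇒< xs (All.map (extend-< col) xs<m) (subst (0 <_) (sym once) z<s)

connecting⇒intervalsConflictFree : ∀ {m k} (col : Fin m → Fin k) →
  CFVConnecting (PathGraph m) k col → IntervalsConflictFree (extend col) 0 m
connecting⇒intervalsConflictFree {m} col connected s l _ ends
  with connected (fromℕ< s<m) (fromℕ< s+l<m)
  where
  s+l<m : s + l < m
  s+l<m = subst (_≤ m) (+-suc s l) ends
  s<m : s < m
  s<m = <-≤-trans (m<m+n s z<s) ends
... | vs , path , c , once = toℕ c , (begin
  occurrences (extend col) (toℕ c) (interval s (suc l))
    ≡⟨ cong (occurrences (extend col) (toℕ c)) shape ⟨
  occurrences (extend col) (toℕ c) (map toℕ vs)        ≡⟨ countColor-toℕ col c vs ⟨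
  countColor col c vs                                  ≡⟨ once ⟩
  1                                                    ∎)
  where
  open ≡-Reasoning
  shape : map toℕ vs ≡ interval s (suc l)
  shape = pathGraph-path⇒interval s l path (toℕ-fromℕ< _) (toℕ-fromℕ< _)

intervalsConflictFree⇒connecting : ∀ {m k} (col : Fin m → Fin k) →
  IntervalsConflictFree (extend col) 0 m → CFVConnecting (PathGraph m) k col
intervalsConflictFree⇒connecting {m} col cf u v =
  [ (λ u≤v → rightward (m≤n⇒∃[o]m+o≡n u≤v)) , (λ v≤u → leftward (m≤n⇒∃[o]m+o≡n v≤u)) ]′
  (≤-total (toℕ u) (toℕ v))
  where
  Connection : Set
  Connection = Σ (List (Fin m)) λ vs → IsPath (PathGraph m) u v vs × ConflictFree col vs
  ends< : ∀ {s l} (w : Fin m) → s + l ≡ toℕ w → s + suc l ≤ m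
  ends< {s} {l} w s+l≡w = subst (_≤ m) (sym (trans (+-suc s l) (cong suc s+l≡w))) (toℕ<n w)
  rightward : ∃ (λ l → toℕ u + l ≡ toℕ v) → Connection
  rightward (l , u+l≡v) = conflictFree-ℕ-path col
    (All-interval λ _ x< → <-≤-trans x< (ends< v u+l≡v))
    (interval-linked (toℕ u) (suc l)) (interval-unique (toℕ u) (suc l))
    refl (trans (last-interval (toℕ u) l) (cong just u+l≡v))
    (cf (toℕ u) l z≤n (ends< v u+l≡v))
  leftward : ∃ (λ l → toℕ v + l ≡ toℕ u) → Connection
  leftward (l , v+l≡u) with cf (toℕ v) l z≤n (ends< u v+l≡u)
  ... | c , once = conflictFree-ℕ-path col
    (All-descending λ _ x< → <-≤-trans x< (ends< u v+l≡u))
    (descending-linked (toℕ v) (suc l)) (descending-unique (toℕ v) (suc l))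
    (cong just v+l≡u) (last-descending (toℕ v) l)
    (c , trans (occurrences-descending (extend col) c (toℕ v) (suc l)) once)

pathGraph-colorable⇒<2^ : ∀ {m k} → CFVColorable (PathGraph m) k → m < 2 ^ k
pathGraph-colorable⇒<2^ {m} {k} (col , connected) =
  conflictFree⇒<2^ k 0 m (≤-reflexive (length-upTo k))
    (All-interval λ _ x<m → ∈-upTo⁺ (extend-< col x<m))
    (connecting⇒intervalsConflictFree col connected)

pathGraph-colorable : ∀ m → CFVColorable (PathGraph m) ⌈log₂ suc m ⌉
pathGraph-colorable m = col , intervalsConflictFree⇒connecting col
  (IntervalsConflictFree-cong (λ _ x<m → sym (extend≡ruler x<m))
    (IntervalsConflictFree-mono {ruler K} z≤n m≤ (ruler-conflictFree K)))
  where
  K : ℕ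
  K = ⌈log₂ suc m ⌉
  m≤ : m ≤ rulerLength K
  m≤ = s≤s⁻¹ (subst (suc m ≤_) (sym (1+rulerLength≡2^ K)) (n≤2^⌈log₂n⌉ (suc m)))
  col : Fin m → Fin K
  col i = fromℕ< (ruler-< K (<-≤-trans (toℕ<n i) m≤))
  extend≡ruler : ∀ {x} → x < m → extend col x ≡ ruler K x
  extend≡ruler x<m = trans (extend-fromℕ< col x<m)
    (trans (toℕ-fromℕ< _) (cong (ruler K) (toℕ-fromℕ< x<m)))

theorem1 : (m : ℕ) → m ≥ 1 → IsVcfc (PathGraph m) ⌈log₂ (suc m) ⌉
theorem1 m _ =
  pathGraph-colorable m , λ k colorable → m<2^k⇒⌈log₂1+m⌉≤k (pathGraph-colorable⇒<2^ colorable)
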